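{- Let $r\in\mathcal{Y}_n$ and $\mathsf{R}\subseteq[n]$, regarded as a set of internal nodes of $r$ via the labeling below. Then $\lambda(\pi_\mathsf{R})\leq r$ in the Tamari order if and only if $\mathsf{R}$ is admissible.
   Context: Permutations in one-line notation, st = standardization; $\sigma\vee\tau$ ($\sigma\in\mathfrak{S}_p,\tau\in\mathfrak{S}_q$) has values $\sigma(1)+q,\dots,\sigma(p)+q,p+q+1,\tau(1),\dots,\tau(q)$. $\mathcal{Y}_n$: rooted planar binary trees with $n$ internal nodes, $\mathcal{Y}_0=\{|\}$, $t=t_l\vee t_r$ uniquely (grafting onto the left and right leaves of a root node); Tamari order generated by replacing a subtree $(A\vee B)\vee C$ by $A\vee(B\vee C)$. $\lambda(\mathrm{id}_0)=|$, $\lambda(\sigma)=\lambda(\mathrm{st}(\sigma(1..j-1)))\vee\lambda(\mathrm{st}(\sigma(j+1..n)))$ with $j=\sigma^{ -1}(n)$. For $\mathsf{R}=\{R_1<\dots<R_p\}\subseteq[n]$ with complement $\{R^c_1<\dots<R^c_q\}$, $\pi_\mathsf{R}\in\mathfrak{S}_n$ is defined by $\pi_\mathsf{R}(R_i)=i$ and $\pi_\mathsf{R}(R^c_i)=p+i$. Labeling of internal nodes of $r\in\mathcal{Y}_n$ by $1,\dots,n$, recursively: if $r=s\vee t$ with $s\in\mathcal{Y}_{j-1}$, the root node gets label $j$, nodes of $s$ keep their labels in $s$, and nodes of $t$ get their labels in $t$ increased by $j$. A set $\mathsf{R}$ of internal nodes is admissible if for every $x\in\mathsf{R}$, every internal node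 of the left subtree above $x$ (the left child of $x$ and all its descendants) lies in $\mathsf{R}$. -}

module Defs where

open import Data.Nat using (ℕ; zero; suc; _+_; _<ᵇ_; _≡ᵇ_)
open import Data.Bool using (Bool; true; false; if_then_else_)
open import Data.List using (List; []; _∷_; length; map)
open import Data.Vec using (Vec; []; _∷_)
open import Data.Product using (_×_; _,_)
open import Relation.Binary.PropositionalEquality using (_≡_)
open import Relation.Binary.Construct.Closure.ReflexiveTransitive using (Star)

-- Permutations in one-line notation: lists of values (1-based).

countLess : ℕ → List ℕ → ℕ
countLess x [] = 0
countLess x (y ∷ w) = if y <ᵇ x then suc (countLess x w) else countLess x w

st : List ℕ → List ℕ
st w = map (λ x → suc (countLess x w)) w

infixr 5 _∨_
data Tree : Set where
  leaf : Tree
  _∨_  : Tree → Tree → Tree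

-- number of internal nodes (so r ∈ 𝒴ₙ iff size r ≡ n)
size : Tree → ℕ
size leaf = 0
size (s ∨ t) = suc (size s + size t)

data _⇒_ : Tree → Tree → Set where
  rot   : ∀ a b c → ((a ∨ b) ∨ c) ⇒ (a ∨ (b ∨ c))
  congˡ : ∀ {s s'} t → s ⇒ s' → (s ∨ t) ⇒ (s' ∨ t)
  congʳ : ∀ s {t t'} → t ⇒ t' → (s ∨ t) ⇒ (s ∨ t')

_≤T_ : Tree → Tree → Set
_≤T_ = Star _⇒_

splitOn : ℕ → List ℕ → List ℕ × List ℕ
splitOn x [] = [] , []
splitOn x (y ∷ w) with y ≡ᵇ x
... | true = [] , w
... | false with splitOn x w
...   | (l , r) = (y ∷ l) , r

-- fuel-driven version (fuel ≥ length suffices)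
lamF : ℕ → List ℕ → Tree
lamF zero w = leaf
lamF (suc k) [] = leaf
lamF (suc k) (y ∷ w) with splitOn (length (y ∷ w)) (y ∷ w)
... | (l , r) = lamF k (st l) ∨ lamF k (st r)

lam : List ℕ → Tree
lam w = lamF (length w) w

-- Subsets R ⊆ [n] as characteristic vectors (position i ↔ element i+1)

count : ∀ {n} → Vec Bool n → ℕ
count [] = 0
count (true ∷ v) = suc (count v)
count (false ∷ v) = count v

-- one-line notation of π_R : walk through 1..n, with i elements of R and
-- j elements of the complement seen so far; p = |R|
piGo : ∀ {n} → ℕ → ℕ → ℕ → Vec Bool n → List ℕ
piGo p i j [] = []
piGo p i j (true ∷ v) = suc i ∷ piGo p (suc i) j v
piGo p i j (false ∷ v) = (p + suc j) ∷ piGo p i (suc j) v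

piR : ∀ {n} → Vec Bool n → List ℕ
piR R = piGo (count R) 0 0 R

inR : ∀ {n} → Vec Bool n → ℕ → Bool
inR [] x = false
inR (b ∷ v) zero = false
inR (b ∷ v) (suc zero) = b
inR (b ∷ v) (suc (suc k)) = inR v (suc k)

-- Labeling of internal nodes; labels of a subtree are shifted by offset o.

data IsLabel : ℕ → Tree → ℕ → Set where
  here  : ∀ o s t → IsLabel o (s ∨ t) (o + suc (size s))
  left  : ∀ {o s y} t → IsLabel o s y → IsLabel o (s ∨ t) y
  right : ∀ {o t y} s → IsLabel (o + suc (size s)) t y → IsLabel o (s ∨ t) y

-- LeftBelow o r x y : y labels an internal node of the left subtree of
-- the node labelled x (labels computed with offset o)
data LeftBelow : ℕ → Tree → ℕ → ℕ → Set where
  here  : ∀ {o s y} t → IsLabel o s y → LeftBelow o (s ∨ t) (o + suc (size s)) y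
  left  : ∀ {o s x y} t → LeftBelow o s x y → LeftBelow o (s ∨ t) x y
  right : ∀ {o t x y} s → LeftBelow (o + suc (size s)) t x y → LeftBelow o (s ∨ t) x y

Admissible : ∀ {n} → Tree → Vec Bool n → Set
Admissible r R = ∀ x y → inR R x ≡ true → LeftBelow 0 r x y → inR R y ≡ true

{-# OPTIONS --safe #-}
-- π_R puts 1, …, |R| at the positions in R and the larger values at the other positions, so its
-- maximum sits at the last position outside R (at the end if there is none). Cutting there again
-- and again shows that λ(π_R) is the block tree of R: if the characteristic word of R is
-- 1^m₀ 0 1^m₁ 0 ⋯ 0 1^mₖ, it is the left comb (⋯((C m₀ ∨ C m₁) ∨ C m₂) ⋯) ∨ C mₖ built from the
-- left combs C m. This tree admits R, and admissibility passes up the Tamari order because a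
-- rotation only removes nodes from left subtrees. Conversely, let R be admissible for r = s ∨ t.
-- If the root of r is not in R, the block tree of R lies below the ∨ of the block trees of the
-- parts of R in s and in t; if it is in R, admissibility puts all of s into R and the block tree
-- lies below C |s| ∨ (block tree of the part in t), where C |s| is the least tree of its size.
module Submission where

open import Defs
open import Data.Nat using (ℕ; zero; suc; _+_; _∸_; _⊓_; _≤_; _<_; s≤s; s≤s⁻¹; z<s; _<ᵇ_; _≡ᵇ_)
open import Data.Nat.Properties
open import Data.Bool using (Bool; true; false; not; T)
open import Data.List as List using (List; []; _∷_; length; map; _++_; replicate)
open import Data.List.Properties using (length-++; length-replicate; foldl-++)
open import Data.List.NonEmpty as List⁺ using (List⁺; _∷_; _∷⁺_; _⁺++⁺_; head; tail)
open import Data.List.Relation.Unary.All using (All; []; _∷_)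
open import Data.Vec using (Vec; fromList; toList; cast)
open import Data.Vec.Properties using (length-toList; fromList∘toList)
open import Data.Vec.Relation.Binary.Equality.Cast using (cast-is-id)
open import Data.Product using (Σ-syntax; _×_; _,_; proj₂)
open import Data.Sum using (_⊎_; inj₁; inj₂)
open import Relation.Binary.Definitions using (tri<; tri≈; tri>)
open import Function using (_∘_)
open import Function.Bundles using (_⇔_; mk⇔)
open import Data.Nat.Tactic.RingSolver using (solve-∀)
open import Relation.Binary.PropositionalEquality
open import Relation.Binary.Construct.Closure.ReflexiveTransitive using (ε; _◅_; _◅◅_; gmap)

-- Left combs and block trees

∨-monoˡ-≤T : ∀ {s s'} t → s ≤T s' → (s ∨ t) ≤T (s' ∨ t)
∨-monoˡ-≤T t = gmap (_∨ t) (congˡ t)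

∨-monoʳ-≤T : ∀ s {t t'} → t ≤T t' → (s ∨ t) ≤T (s ∨ t')
∨-monoʳ-≤T s = gmap (s ∨_) (congʳ s)

leftComb : ℕ → Tree
leftComb zero = leaf
leftComb (suc m) = leftComb m ∨ leaf

size-leftComb : ∀ m → size (leftComb m) ≡ m
size-leftComb zero = refl
size-leftComb (suc m) = cong suc (trans (+-identityʳ _) (size-leftComb m))

leftComb-split : ∀ a k → leftComb (suc (a + k)) ≤T (leftComb k ∨ leftComb a)
leftComb-split zero k = ε
leftComb-split (suc a) k =
  ∨-monoˡ-≤T leaf (leftComb-split a k) ◅◅ (rot (leftComb k) (leftComb a) leaf ◅ ε)

leftComb-minimal : ∀ t → leftComb (size t) ≤T t
leftComb-minimal leaf = ε
leftComb-minimal (s ∨ t) = subst (λ m → leftComb (suc m) ≤T (s ∨ t)) (+-comm (size t) (size s))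
  (leftComb-split (size t) (size s)
    ◅◅ ∨-monoˡ-≤T _ (leftComb-minimal s)
    ◅◅ ∨-monoʳ-≤T s (leftComb-minimal t))

sucHead : List⁺ ℕ → List⁺ ℕ
sucHead (m ∷ ms) = suc m ∷ ms

-- The blocks of true^m₀ ∷ false ∷ true^m₁ ∷ ⋯ ∷ false ∷ true^mₖ are m₀ ∷ m₁ ∷ ⋯ ∷ mₖ.
blocks : List Bool → List⁺ ℕ
blocks [] = 0 ∷ []
blocks (true ∷ bs) = sucHead (blocks bs)
blocks (false ∷ bs) = 0 ∷⁺ blocks bs

graft : Tree → ℕ → Tree
graft t m = t ∨ leftComb m

blockTree : List Bool → Tree
blockTree bs = List⁺.foldl graft leftComb (blocks bs)

foldl-graft-mono : ∀ ms {t t'} → t ≤T t' → List.foldl graft t ms ≤T List.foldl graft t' ms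
foldl-graft-mono [] le = le
foldl-graft-mono (m ∷ ms) le = foldl-graft-mono ms (∨-monoˡ-≤T (leftComb m) le)

foldl-graft-∨ : ∀ ms s t → List.foldl graft (s ∨ t) ms ≤T (s ∨ List.foldl graft t ms)
foldl-graft-∨ [] s t = ε
foldl-graft-∨ (m ∷ ms) s t =
  foldl-graft-mono ms (rot s t (leftComb m) ◅ ε) ◅◅ foldl-graft-∨ ms s (t ∨ leftComb m)

blocks-++-false : ∀ xs ys → blocks (xs ++ false ∷ ys) ≡ blocks xs ⁺++⁺ blocks ys
blocks-++-false [] ys = refl
blocks-++-false (true ∷ xs) ys = cong sucHead (blocks-++-false xs ys)
blocks-++-false (false ∷ xs) ys = cong (0 ∷⁺_) (blocks-++-false xs ys)

blocks-trues-++ : ∀ k ys →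
  blocks (replicate k true ++ ys) ≡ (k + head (blocks ys)) ∷ tail (blocks ys)
blocks-trues-++ zero ys = refl
blocks-trues-++ (suc k) ys = cong sucHead (blocks-trues-++ k ys)

blocks-trues : ∀ m → blocks (replicate m true) ≡ m ∷ []
blocks-trues zero = refl
blocks-trues (suc m) = cong sucHead (blocks-trues m)

blockTree-trues : ∀ m → blockTree (replicate m true) ≡ leftComb m
blockTree-trues m = cong (List⁺.foldl graft leftComb) (blocks-trues m)

blockTree-++-false-trues : ∀ xs m →
  blockTree (xs ++ false ∷ replicate m true) ≡ blockTree xs ∨ leftComb m
blockTree-++-false-trues xs m = begin
  blockTree (xs ++ false ∷ replicate m true)
    ≡⟨ cong (List⁺.foldl graft leftComb) (blocks-++-false xs _) ⟩
  List⁺.foldl graft leftComb (blocks xs ⁺++⁺ blocks (replicate m true))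
    ≡⟨ cong (λ b → List⁺.foldl graft leftComb (blocks xs ⁺++⁺ b)) (blocks-trues m) ⟩
  List.foldl graft (leftComb (head (blocks xs))) (tail (blocks xs) ++ m ∷ [])
    ≡⟨ foldl-++ graft _ (tail (blocks xs)) _ ⟩
  blockTree xs ∨ leftComb m ∎
  where open ≡-Reasoning

blockTree-++-false : ∀ xs ys → blockTree (xs ++ false ∷ ys) ≤T (blockTree xs ∨ blockTree ys)
blockTree-++-false xs ys = subst (_≤T (blockTree xs ∨ blockTree ys)) (sym eq)
  (foldl-graft-∨ (tail (blocks ys)) (blockTree xs) (leftComb (head (blocks ys))))
  where
  eq : blockTree (xs ++ false ∷ ys)
     ≡ List.foldl graft (blockTree xs ∨ leftComb (head (blocks ys))) (tail (blocks ys))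
  eq = trans (cong (List⁺.foldl graft leftComb) (blocks-++-false xs ys))
             (foldl-++ graft _ (tail (blocks xs)) _)

blockTree-trues-++-true : ∀ k ys →
  blockTree (replicate k true ++ true ∷ ys) ≤T (leftComb k ∨ blockTree ys)
blockTree-trues-++-true k ys = subst (_≤T (leftComb k ∨ blockTree ys)) (sym eq)
  (foldl-graft-mono ms (leftComb-split c k) ◅◅ foldl-graft-∨ ms (leftComb k) (leftComb c))
  where
  c = head (blocks ys)
  ms = tail (blocks ys)
  eq : blockTree (replicate k true ++ true ∷ ys) ≡ List.foldl graft (leftComb (suc (c + k))) ms
  eq = cong (List⁺.foldl graft leftComb)
         (trans (blocks-trues-++ k (true ∷ ys)) (cong (_∷ ms) (trans (+-suc k c) (cong suc (+-comm k c)))))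

data BlockView : List Bool → Set where
  trues : ∀ m → BlockView (replicate m true)
  snoc  : ∀ {xs} → BlockView xs → ∀ m → BlockView (xs ++ false ∷ replicate m true)

cons-view : ∀ b {bs} → BlockView bs → BlockView (b ∷ bs)
cons-view true (trues m) = trues (suc m)
cons-view false (trues m) = snoc (trues 0) m
cons-view b (snoc v m) = snoc (cons-view b v) m

blockView : ∀ bs → BlockView bs
blockView [] = trues 0
blockView (b ∷ bs) = cons-view b (blockView bs)

size-blockTree : ∀ bs → size (blockTree bs) ≡ length bs
size-blockTree bs = go (blockView bs)
  where
  go : ∀ {bs} → BlockView bs → size (blockTree bs) ≡ length bs
  go (trues m) = begin
    size (blockTree (replicate m true)) ≡⟨ cong size (blockTree-trues m) ⟩
    size (leftComb m)                   ≡⟨ size-leftComb m ⟩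
    m                                   ≡⟨ length-replicate m ⟨
    length (replicate m true)           ∎
    where open ≡-Reasoning
  go (snoc {xs} v m) = begin
    size (blockTree (xs ++ false ∷ replicate m true))  ≡⟨ cong size (blockTree-++-false-trues xs m) ⟩
    suc (size (blockTree xs) + size (leftComb m))      ≡⟨ cong₂ (λ a b → suc (a + b)) (go v) (size-leftComb m) ⟩
    suc (length xs + m)                                ≡⟨ +-suc (length xs) m ⟨
    length xs + suc m                                  ≡⟨ cong (λ k → length xs + suc k) (length-replicate m) ⟨
    length xs + length (false ∷ replicate m true)      ≡⟨ length-++ xs ⟨
    length (xs ++ false ∷ replicate m true)            ∎
    where open ≡-Reasoning

-- λ(π_R) is the block tree of R

#true #false : List Bool → ℕ
#true bs = count (fromList bs)
#false bs = count (fromList (map not bs))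

π : List Bool → List ℕ
π bs = piR (fromList bs)

countLess-∷ : ∀ x y w → countLess x (y ∷ w) ≡ countLess x (y ∷ []) + countLess x w
countLess-∷ x y w with y <ᵇ x
... | true = refl
... | false = refl

-- piGo p i j interleaves i + 1, …, i + #true and p + j + 1, …, p + j + #false, and
-- (x ∸ suc a) ⊓ c is the number of entries of a + 1, …, a + c below x.
countLess-interval-step : ∀ x a c → countLess x (a ∷ []) + (x ∸ suc a) ⊓ c ≡ (x ∸ a) ⊓ suc c
countLess-interval-step zero zero c = refl
countLess-interval-step zero (suc a) c = refl
countLess-interval-step (suc x) zero c = refl
countLess-interval-step (suc x) (suc a) c = countLess-interval-step x a c

countLess-piGo : ∀ x p i j bs →
  countLess x (piGo p i j (fromList bs)) ≡ (x ∸ suc i) ⊓ #true bs + (x ∸ suc (p + j)) ⊓ #false bs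
countLess-piGo x p i j [] = sym (cong₂ _+_ (⊓-zeroʳ (x ∸ suc i)) (⊓-zeroʳ (x ∸ suc (p + j))))
countLess-piGo x p i j (true ∷ bs) = begin
  countLess x (suc i ∷ w)
    ≡⟨ countLess-∷ x (suc i) w ⟩
  countLess x (suc i ∷ []) + countLess x w
    ≡⟨ cong (countLess x (suc i ∷ []) +_) (countLess-piGo x p (suc i) j bs) ⟩
  countLess x (suc i ∷ []) + ((x ∸ suc (suc i)) ⊓ #true bs + Cᶠ)
    ≡⟨ +-assoc (countLess x (suc i ∷ [])) _ Cᶠ ⟨
  (countLess x (suc i ∷ []) + (x ∸ suc (suc i)) ⊓ #true bs) + Cᶠ
    ≡⟨ cong (_+ Cᶠ) (countLess-interval-step x (suc i) (#true bs)) ⟩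
  (x ∸ suc i) ⊓ suc (#true bs) + Cᶠ ∎
  where
  open ≡-Reasoning
  w = piGo p (suc i) j (fromList bs)
  Cᶠ = (x ∸ suc (p + j)) ⊓ #false bs
countLess-piGo x p i j (false ∷ bs) = begin
  countLess x (p + suc j ∷ w)
    ≡⟨ countLess-∷ x (p + suc j) w ⟩
  countLess x (p + suc j ∷ []) + countLess x w
    ≡⟨ cong (countLess x (p + suc j ∷ []) +_) (countLess-piGo x p i (suc j) bs) ⟩
  countLess x (p + suc j ∷ []) + (Cᵗ + (x ∸ suc (p + suc j)) ⊓ #false bs)
    ≡⟨ x+[y+z]≡y+[x+z] (countLess x (p + suc j ∷ [])) Cᵗ _ ⟩
  Cᵗ + (countLess x (p + suc j ∷ []) + (x ∸ suc (p + suc j)) ⊓ #false bs)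
    ≡⟨ cong (Cᵗ +_) (countLess-interval-step x (p + suc j) (#false bs)) ⟩
  Cᵗ + (x ∸ (p + suc j)) ⊓ suc (#false bs)
    ≡⟨ cong (λ a → Cᵗ + (x ∸ a) ⊓ suc (#false bs)) (+-suc p j) ⟩
  Cᵗ + (x ∸ suc (p + j)) ⊓ suc (#false bs) ∎
  where
  open ≡-Reasoning
  w = piGo p i (suc j) (fromList bs)
  Cᵗ = (x ∸ suc i) ⊓ #true bs
  x+[y+z]≡y+[x+z] : ∀ a b c → a + (b + c) ≡ b + (a + c)
  x+[y+z]≡y+[x+z] = solve-∀

module _ (p i j : ℕ) (bs : List Bool) (separated : i + #true bs ≤ p + j) where

  private
    w = piGo p i j (fromList bs)

  rank-true : ∀ k → k < #true bs → countLess (suc (k + i)) w ≡ k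
  rank-true k k<t = begin
    countLess (suc (k + i)) w
      ≡⟨ countLess-piGo (suc (k + i)) p i j bs ⟩
    (k + i ∸ i) ⊓ #true bs + (k + i ∸ (p + j)) ⊓ #false bs
      ≡⟨ cong₂ (λ a b → a ⊓ #true bs + b ⊓ #false bs) (m+n∸n≡m k i) (m≤n⇒m∸n≡0 k+i≤p+j) ⟩
    k ⊓ #true bs + 0
      ≡⟨ +-identityʳ _ ⟩
    k ⊓ #true bs
      ≡⟨ m≤n⇒m⊓n≡m (<⇒≤ k<t) ⟩
    k ∎
    where
    open ≡-Reasoning
    k+i≤p+j : k + i ≤ p + j
    k+i≤p+j = ≤-trans (≤-trans (+-monoˡ-≤ i (<⇒≤ k<t)) (≤-reflexive (+-comm (#true bs) i))) separated

  trues-below-false : ∀ k → #true bs + suc i ≤ p + suc (k + j)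
  trues-below-false k = begin
    #true bs + suc i   ≡⟨ +-suc (#true bs) i ⟩
    suc (#true bs + i) ≡⟨ cong suc (+-comm (#true bs) i) ⟩
    suc (i + #true bs) ≤⟨ s≤s separated ⟩
    suc (p + j)        ≤⟨ s≤s (+-monoʳ-≤ p (m≤n+m j k)) ⟩
    suc (p + (k + j))  ≡⟨ +-suc p (k + j) ⟨
    p + suc (k + j)    ∎
    where open ≤-Reasoning

  rank-false : ∀ k → k < #false bs → countLess (p + suc (k + j)) w ≡ #true bs + k
  rank-false k k<f = begin
    countLess (p + suc (k + j)) w
      ≡⟨ countLess-piGo (p + suc (k + j)) p i j bs ⟩
    (p + suc (k + j) ∸ suc i) ⊓ #true bs + (p + suc (k + j) ∸ suc (p + j)) ⊓ #false bs
      ≡⟨ cong₂ (λ a b → a + (b ∸ suc (p + j)) ⊓ #false bs) (m≥n⇒m⊓n≡n t≤) (reorder p k j) ⟩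
    #true bs + (k + suc (p + j) ∸ suc (p + j)) ⊓ #false bs
      ≡⟨ cong (λ a → #true bs + a ⊓ #false bs) (m+n∸n≡m k (suc (p + j))) ⟩
    #true bs + k ⊓ #false bs
      ≡⟨ cong (#true bs +_) (m≤n⇒m⊓n≡m (<⇒≤ k<f)) ⟩
    #true bs + k ∎
    where
    open ≡-Reasoning
    reorder : ∀ p k j → p + suc (k + j) ≡ k + suc (p + j)
    reorder = solve-∀
    t≤ : #true bs ≤ p + suc (k + j) ∸ suc i
    t≤ = m+n≤o⇒m≤o∸n (#true bs) (trues-below-false k)

map-piGo : ∀ (g : ℕ → ℕ) p q i i′ j j′ bs →
  (∀ k → k < #true bs → g (suc (k + i)) ≡ suc (k + i′)) →
  (∀ k → k < #false bs → g (p + suc (k + j)) ≡ q + suc (k + j′)) →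
  map g (piGo p i j (fromList bs)) ≡ piGo q i′ j′ (fromList bs)
map-piGo g p q i i′ j j′ [] _ _ = refl
map-piGo g p q i i′ j j′ (true ∷ bs) gᵗ gᶠ = cong₂ _∷_ (gᵗ 0 z<s)
  (map-piGo g p q (suc i) (suc i′) j j′ bs
    (λ k k< → subst₂ (λ a b → g (suc a) ≡ suc b) (sym (+-suc k i)) (sym (+-suc k i′))
                     (gᵗ (suc k) (s≤s k<)))
    gᶠ)
map-piGo g p q i i′ j j′ (false ∷ bs) gᵗ gᶠ = cong₂ _∷_ (gᶠ 0 z<s)
  (map-piGo g p q i i′ (suc j) (suc j′) bs gᵗ
    (λ k k< → subst₂ (λ a b → g (p + suc a) ≡ q + suc b) (sym (+-suc k j)) (sym (+-suc k j′))
                     (gᶠ (suc k) (s≤s k<))))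

st-piGo : ∀ p i j bs → i + #true bs ≤ p + j → st (piGo p i j (fromList bs)) ≡ π bs
st-piGo p i j bs separated = map-piGo _ p (#true bs) i 0 j 0 bs
  (λ k k< → cong suc (trans (rank-true p i j bs separated k k<) (sym (+-identityʳ k))))
  (λ k k< → trans (cong suc (rank-false p i j bs separated k k<))
                  (trans (sym (+-suc (#true bs) k)) (cong (λ a → #true bs + suc a) (sym (+-identityʳ k)))))

piGo-++ : ∀ p i j xs ys →
  piGo p i j (fromList (xs ++ ys))
    ≡ piGo p i j (fromList xs) ++ piGo p (i + #true xs) (j + #false xs) (fromList ys)
piGo-++ p i j [] ys = cong₂ (λ a b → piGo p a b (fromList ys)) (sym (+-identityʳ i)) (sym (+-identityʳ j))
piGo-++ p i j (true ∷ xs) ys = cong (suc i ∷_) (trans (piGo-++ p (suc i) j xs ys)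
  (cong (λ a → piGo p (suc i) j (fromList xs) ++ piGo p a (j + #false xs) (fromList ys))
        (sym (+-suc i (#true xs)))))
piGo-++ p i j (false ∷ xs) ys = cong (p + suc j ∷_) (trans (piGo-++ p i (suc j) xs ys)
  (cong (λ b → piGo p i (suc j) (fromList xs) ++ piGo p (i + #true xs) b (fromList ys))
        (sym (+-suc j (#false xs)))))

length-piGo : ∀ p i j bs → length (piGo p i j (fromList bs)) ≡ length bs
length-piGo p i j [] = refl
length-piGo p i j (true ∷ bs) = cong suc (length-piGo p (suc i) j bs)
length-piGo p i j (false ∷ bs) = cong suc (length-piGo p i (suc j) bs)

length≡#true+#false : ∀ bs → length bs ≡ #true bs + #false bs
length≡#true+#false [] = refl
length≡#true+#false (true ∷ bs) = cong suc (length≡#true+#false bs)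
length≡#true+#false (false ∷ bs) =
  trans (cong suc (length≡#true+#false bs)) (sym (+-suc (#true bs) (#false bs)))

#true-++ : ∀ xs ys → #true (xs ++ ys) ≡ #true xs + #true ys
#true-++ [] ys = refl
#true-++ (true ∷ xs) ys = cong suc (#true-++ xs ys)
#true-++ (false ∷ xs) ys = #true-++ xs ys

#true-trues : ∀ m → #true (replicate m true) ≡ m
#true-trues zero = refl
#true-trues (suc m) = cong suc (#true-trues m)

#false-trues : ∀ m → #false (replicate m true) ≡ 0
#false-trues zero = refl
#false-trues (suc m) = #false-trues m

piGo-bounded : ∀ N p i j bs → i + #true bs < N → #false bs ≡ 0 ⊎ p + (j + #false bs) < N →
  All (_< N) (piGo p i j (fromList bs))
piGo-bounded N p i j [] _ _ = []
piGo-bounded N p i j (true ∷ bs) trues< falses< =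
  ≤-<-trans (s≤s (m≤m+n i (#true bs))) trues<′ ∷ piGo-bounded N p (suc i) j bs trues<′ falses<
  where
  trues<′ : suc i + #true bs < N
  trues<′ = subst (_< N) (+-suc i (#true bs)) trues<
piGo-bounded N p i j (false ∷ bs) trues< (inj₂ falses<) =
  ≤-<-trans (+-monoʳ-≤ p (s≤s (m≤m+n j (#false bs)))) falses<′
  ∷ piGo-bounded N p i (suc j) bs trues< (inj₂ falses<′)
  where
  falses<′ : p + (suc j + #false bs) < N
  falses<′ = subst (λ a → p + a < N) (+-suc j (#false bs)) falses<

splitOn-++ : ∀ x xs ys → All (_< x) xs → splitOn x (xs ++ x ∷ ys) ≡ (xs , ys)
splitOn-++ x [] ys [] with x ≡ᵇ x | ≡⇒≡ᵇ x x refl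
... | true | _ = refl
splitOn-++ x (y ∷ xs) ys (y<x ∷ xs<x) with y ≡ᵇ x in y≡ᵇx
... | true with () ← <⇒≢ y<x (≡ᵇ⇒≡ y x (subst T (sym y≡ᵇx) _))
... | false rewrite splitOn-++ x xs ys xs<x = refl

lamF-++-∷ : ∀ k xs x ys → let (l , r) = splitOn (length (xs ++ x ∷ ys)) (xs ++ x ∷ ys) in
  lamF (suc k) (xs ++ x ∷ ys) ≡ lamF k (st l) ∨ lamF k (st r)
lamF-++-∷ k [] x ys = refl
lamF-++-∷ k (_ ∷ xs) x ys = refl

lamF-split : ∀ k xs N ys → length (xs ++ N ∷ ys) ≡ N → All (_< N) xs →
  lamF (suc k) (xs ++ N ∷ ys) ≡ lamF k (st xs) ∨ lamF k (st ys)
lamF-split k xs N ys len≡N xs<N = begin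
  lamF (suc k) (xs ++ N ∷ ys)
    ≡⟨ lamF-++-∷ k xs N ys ⟩
  (let (l , r) = splitOn (length (xs ++ N ∷ ys)) (xs ++ N ∷ ys) in lamF k (st l) ∨ lamF k (st r))
    ≡⟨ cong (λ x → let (l , r) = splitOn x (xs ++ N ∷ ys) in lamF k (st l) ∨ lamF k (st r)) len≡N ⟩
  (let (l , r) = splitOn N (xs ++ N ∷ ys) in lamF k (st l) ∨ lamF k (st r))
    ≡⟨ cong (λ (l , r) → lamF k (st l) ∨ lamF k (st r)) (splitOn-++ N xs ys xs<N) ⟩
  lamF k (st xs) ∨ lamF k (st ys) ∎
  where open ≡-Reasoning

replicate-suc : ∀ {a} {A : Set a} m (x : A) → replicate (suc m) x ≡ replicate m x ++ x ∷ []
replicate-suc zero x = refl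
replicate-suc (suc m) x = cong (x ∷_) (replicate-suc m x)

lamF-[] : ∀ k → lamF k [] ≡ leaf
lamF-[] zero = refl
lamF-[] (suc k) = refl

lamF-π-trues : ∀ k m → lamF (suc k) (π (replicate (suc m) true)) ≡ lamF k (π (replicate m true)) ∨ leaf
lamF-π-trues k m = begin
  lamF (suc k) (π (replicate (suc m) true))
    ≡⟨ cong (lamF (suc k) ∘ piGo P 0 0 ∘ fromList) (replicate-suc m true) ⟩
  lamF (suc k) (piGo P 0 0 (fromList (ms ++ true ∷ [])))
    ≡⟨ cong (lamF (suc k)) (piGo-++ P 0 0 ms (true ∷ [])) ⟩
  lamF (suc k) (piGo P 0 0 (fromList ms) ++ P ∷ [])
    ≡⟨ lamF-split k _ P [] len≡P (piGo-bounded P P 0 0 ms ≤-refl (inj₁ (#false-trues m))) ⟩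
  lamF k (st (piGo P 0 0 (fromList ms))) ∨ lamF k []
    ≡⟨ cong₂ (λ l r → lamF k l ∨ r) (st-piGo P 0 0 ms (≤-trans (n≤1+n _) (m≤m+n P 0))) (lamF-[] k) ⟩
  lamF k (π ms) ∨ leaf ∎
  where
  open ≡-Reasoning
  ms = replicate m true
  P = suc (#true ms)
  len≡P : length (piGo P 0 0 (fromList ms) ++ P ∷ []) ≡ P
  len≡P = begin
    length (piGo P 0 0 (fromList ms) ++ P ∷ []) ≡⟨ length-++ (piGo P 0 0 (fromList ms)) ⟩
    length (piGo P 0 0 (fromList ms)) + 1       ≡⟨ cong (_+ 1) (length-piGo P 0 0 ms) ⟩
    length ms + 1                               ≡⟨ +-comm (length ms) 1 ⟩
    suc (length ms)                             ≡⟨ cong suc (trans (length-replicate m) (sym (#true-trues m))) ⟩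
    P                                           ∎

-- The maximal entry of π (xs ++ false ∷ true^m) is the one at the last false.
lamF-π-++-false-trues : ∀ k xs m →
  lamF (suc k) (π (xs ++ false ∷ replicate m true)) ≡ lamF k (π xs) ∨ lamF k (π (replicate m true))
lamF-π-++-false-trues k xs m = begin
  lamF (suc k) (π (xs ++ false ∷ ms))
    ≡⟨ cong (lamF (suc k)) (piGo-++ P 0 0 xs (false ∷ ms)) ⟩
  lamF (suc k) (piGo P 0 0 (fromList xs) ++ N ∷ suffix)
    ≡⟨ lamF-split k _ N _ len≡N (piGo-bounded N P 0 0 xs xs<N (inj₂ (+-monoʳ-< P ≤-refl))) ⟩
  lamF k (st (piGo P 0 0 (fromList xs))) ∨ lamF k (st suffix)
    ≡⟨ cong₂ (λ l r → lamF k l ∨ lamF k r) (st-piGo P 0 0 xs (≤-trans xs≤P (m≤m+n P 0)))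
                                           (st-piGo P _ _ ms (≤-trans (≤-reflexive P≡) (m≤m+n P _))) ⟩
  lamF k (π xs) ∨ lamF k (π ms) ∎
  where
  open ≡-Reasoning
  ms = replicate m true
  P = #true (xs ++ false ∷ ms)
  N = P + suc (#false xs)
  suffix = piGo P (#true xs) (suc (#false xs)) (fromList ms)
  P≡ : #true xs + #true ms ≡ P
  P≡ = sym (#true-++ xs (false ∷ ms))
  xs≤P : #true xs ≤ P
  xs≤P = subst (#true xs ≤_) P≡ (m≤m+n _ _)
  xs<N : #true xs < N
  xs<N = ≤-<-trans xs≤P (m<m+n P z<s)
  swap : ∀ a b c → (a + b) + suc c ≡ (a + c) + suc b
  swap = solve-∀
  len≡N : length (piGo P 0 0 (fromList xs) ++ N ∷ suffix) ≡ N
  len≡N = begin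
    length (piGo P 0 0 (fromList xs) ++ N ∷ suffix)
      ≡⟨ length-++ (piGo P 0 0 (fromList xs)) ⟩
    length (piGo P 0 0 (fromList xs)) + suc (length suffix)
      ≡⟨ cong₂ (λ a b → a + suc b) (trans (length-piGo P 0 0 xs) (length≡#true+#false xs))
                                   (trans (length-piGo P _ _ ms) (trans (length-replicate m) (sym (#true-trues m)))) ⟩
    (#true xs + #false xs) + suc (#true ms)
      ≡⟨ swap (#true xs) (#false xs) (#true ms) ⟩
    (#true xs + #true ms) + suc (#false xs)
      ≡⟨ cong (_+ suc (#false xs)) P≡ ⟩
    N ∎

lamF-π : ∀ k {bs} → BlockView bs → length bs ≤ k → lamF k (π bs) ≡ blockTree bs
lamF-π k (trues zero) _ = lamF-[] k
lamF-π zero (trues (suc m)) ()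
lamF-π (suc k) (trues (suc m)) (s≤s len≤k) = begin
  lamF (suc k) (π (replicate (suc m) true)) ≡⟨ lamF-π-trues k m ⟩
  lamF k (π (replicate m true)) ∨ leaf      ≡⟨ cong (_∨ leaf) (lamF-π k (trues m) len≤k) ⟩
  blockTree (replicate m true) ∨ leaf       ≡⟨ cong (_∨ leaf) (blockTree-trues m) ⟩
  leftComb (suc m)                          ≡⟨ blockTree-trues (suc m) ⟨
  blockTree (replicate (suc m) true)        ∎
  where open ≡-Reasoning
lamF-π zero (snoc {xs} v m) len≤0
  with () ← m+n≤o⇒n≤o (length xs) (subst (_≤ 0) (length-++ xs) len≤0)
lamF-π (suc k) (snoc {xs} v m) len≤ = begin
  lamF (suc k) (π (xs ++ false ∷ ms))      ≡⟨ lamF-π-++-false-trues k xs m ⟩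
  lamF k (π xs) ∨ lamF k (π ms)            ≡⟨ cong₂ _∨_ (lamF-π k v xs≤k) (lamF-π k (trues m) ms≤k) ⟩
  blockTree xs ∨ blockTree ms              ≡⟨ cong (blockTree xs ∨_) (blockTree-trues m) ⟩
  blockTree xs ∨ leftComb m                ≡⟨ blockTree-++-false-trues xs m ⟨
  blockTree (xs ++ false ∷ ms)             ∎
  where
  open ≡-Reasoning
  ms = replicate m true
  len≤k : length xs + length ms ≤ k
  len≤k = s≤s⁻¹ (subst (_≤ suc k) (trans (length-++ xs) (+-suc (length xs) (length ms))) len≤)
  xs≤k : length xs ≤ k
  xs≤k = ≤-trans (m≤m+n _ _) len≤k
  ms≤k : length ms ≤ k
  ms≤k = ≤-trans (m≤n+m _ _) len≤k

-- Labels, rotations and admissibility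

label-bounds : ∀ {o t y} → IsLabel o t y → Σ[ d ∈ ℕ ] d < size t × y ≡ o + suc d
label-bounds (here o s t) = size s , s≤s (m≤m+n (size s) (size t)) , refl
label-bounds (left {s = s} t p) with label-bounds p
... | d , d<s , refl = d , m<n⇒m<1+n (m≤n⇒m≤n+o (size t) d<s) , refl
label-bounds {o} (right {t = t} s p) with label-bounds p
... | d , d<t , refl = size s + suc d , s≤s (+-monoʳ-≤ (size s) d<t) , +-assoc o (suc (size s)) (suc d)

label-of-index : ∀ o t {d} → d < size t → IsLabel o t (o + suc d)
label-of-index o (s ∨ t) {d} d<size with <-cmp d (size s)
... | tri< d<s _ _ = left t (label-of-index o s d<s)
... | tri≈ _ refl _ = here o s t
... | tri> _ _ d>s = subst (IsLabel o (s ∨ t)) eq (right s (label-of-index (o + suc (size s)) t e<t))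
  where
  e = d ∸ suc (size s)
  d≡ : suc (size s) + e ≡ d
  d≡ = m+[n∸m]≡n d>s
  eq : (o + suc (size s)) + suc e ≡ o + suc d
  eq = trans (+-assoc o (suc (size s)) (suc e)) (cong (λ k → o + suc k) (trans (+-suc (size s) e) d≡))
  e<t : e < size t
  e<t = +-cancelˡ-< (suc (size s)) e (size t) (subst (_< suc (size s) + size t) (sym d≡) d<size)

LeftBelow-labels : ∀ {o t x y} → LeftBelow o t x y → IsLabel o t x × IsLabel o t y
LeftBelow-labels (here {o} {s} t q) = here o s t , left t q
LeftBelow-labels (left t p) = let x , y = LeftBelow-labels p in left t x , left t y
LeftBelow-labels (right s p) = let x , y = LeftBelow-labels p in right s x , right s y

IsLabel-shift : ∀ c {o t y} → IsLabel o t y → IsLabel (c + o) t (c + y)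
IsLabel-shift c (here o s t) = subst (IsLabel (c + o) (s ∨ t)) (+-assoc c o (suc (size s))) (here (c + o) s t)
IsLabel-shift c (left t p) = left t (IsLabel-shift c p)
IsLabel-shift c {o} (right {t = t} {y = y} s p) =
  right s (subst (λ o' → IsLabel o' t (c + y)) (sym (+-assoc c o (suc (size s)))) (IsLabel-shift c p))

LeftBelow-shift : ∀ c {o t x y} → LeftBelow o t x y → LeftBelow (c + o) t (c + x) (c + y)
LeftBelow-shift c (here {o} {s} {y} t q) =
  subst (λ x → LeftBelow (c + o) (s ∨ t) x (c + y)) (+-assoc c o (suc (size s))) (here t (IsLabel-shift c q))
LeftBelow-shift c (left t p) = left t (LeftBelow-shift c p)
LeftBelow-shift c {o} (right {t = t} {x = x} {y = y} s p) =
  right s (subst (λ o' → LeftBelow o' t (c + x) (c + y)) (sym (+-assoc c o (suc (size s)))) (LeftBelow-shift c p))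

⇒-size : ∀ {r r'} → r ⇒ r' → size r' ≡ size r
⇒-size (rot a b c) =
  cong suc (trans (+-suc (size a) (size b + size c)) (cong suc (sym (+-assoc (size a) (size b) (size c)))))
⇒-size (congˡ t p) = cong (λ k → suc (k + size t)) (⇒-size p)
⇒-size (congʳ s p) = cong (λ k → suc (size s + k)) (⇒-size p)

rot-offset : ∀ o a b → o + suc (suc (a + b)) ≡ (o + suc a) + suc b
rot-offset o a b = sym (trans (+-assoc o (suc a) (suc b)) (cong (λ k → o + suc k) (+-suc a b)))

⇒-reflects-IsLabel : ∀ {r r' o y} → r ⇒ r' → IsLabel o r' y → IsLabel o r y
⇒-reflects-IsLabel (rot a b c) (here o _ _) = left c (here o a b)
⇒-reflects-IsLabel (rot a b c) (left _ p) = left c (left b p)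
⇒-reflects-IsLabel (rot a b c) (right _ (here o _ _)) =
  subst (IsLabel _ ((a ∨ b) ∨ c)) (rot-offset _ (size a) (size b)) (here _ (a ∨ b) c)
⇒-reflects-IsLabel (rot a b c) (right _ (left _ q)) = left c (right a q)
⇒-reflects-IsLabel {o = o} {y} (rot a b c) (right _ (right _ q)) =
  right (a ∨ b) (subst (λ o' → IsLabel o' c y) (sym (rot-offset o (size a) (size b))) q)
⇒-reflects-IsLabel (congˡ {s} t p) (here o _ _) =
  subst (IsLabel o (s ∨ t)) (cong (λ k → o + suc k) (sym (⇒-size p))) (here o s t)
⇒-reflects-IsLabel (congˡ t p) (left _ q) = left t (⇒-reflects-IsLabel p q)
⇒-reflects-IsLabel {o = o} {y} (congˡ {s} t p) (right _ q) =
  right s (subst (λ o' → IsLabel o' t y) (cong (λ k → o + suc k) (⇒-size p)) q)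
⇒-reflects-IsLabel (congʳ s p) (here o _ _) = here o s _
⇒-reflects-IsLabel (congʳ s p) (left _ q) = left _ q
⇒-reflects-IsLabel (congʳ s p) (right _ q) = right s (⇒-reflects-IsLabel p q)

⇒-reflects-LeftBelow : ∀ {r r' o x y} → r ⇒ r' → LeftBelow o r' x y → LeftBelow o r x y
⇒-reflects-LeftBelow (rot a b c) (here _ q) = left c (here b q)
⇒-reflects-LeftBelow (rot a b c) (left _ p) = left c (left b p)
⇒-reflects-LeftBelow {o = o} {y = y} (rot a b c) (right _ (here _ q)) =
  subst (λ x → LeftBelow o ((a ∨ b) ∨ c) x y) (rot-offset o (size a) (size b)) (here c (right a q))
⇒-reflects-LeftBelow (rot a b c) (right _ (left _ p)) = left c (right a p)
⇒-reflects-LeftBelow {o = o} {x} {y} (rot a b c) (right _ (right _ p)) =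
  right (a ∨ b) (subst (λ o' → LeftBelow o' c x y) (sym (rot-offset o (size a) (size b))) p)
⇒-reflects-LeftBelow {o = o} {y = y} (congˡ {s} t p) (here _ q) =
  subst (λ x → LeftBelow o (s ∨ t) x y) (cong (λ k → o + suc k) (sym (⇒-size p)))
    (here t (⇒-reflects-IsLabel p q))
⇒-reflects-LeftBelow (congˡ t p) (left _ q) = left t (⇒-reflects-LeftBelow p q)
⇒-reflects-LeftBelow {o = o} {x} {y} (congˡ {s} t p) (right _ q) =
  right s (subst (λ o' → LeftBelow o' t x y) (cong (λ k → o + suc k) (⇒-size p)) q)
⇒-reflects-LeftBelow (congʳ s p) (here _ q) = here _ q
⇒-reflects-LeftBelow (congʳ s p) (left _ q) = left _ q
⇒-reflects-LeftBelow (congʳ s p) (right _ q) = right s (⇒-reflects-LeftBelow p q)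

Admissible-mono : ∀ {n r r'} {R : Vec Bool n} → r ≤T r' → Admissible r R → Admissible r' R
Admissible-mono ε adm = adm
Admissible-mono {R = R} (step ◅ steps) adm =
  Admissible-mono {R = R} steps (λ x y x∈R below → adm x y x∈R (⇒-reflects-LeftBelow step below))

inR-++ˡ : ∀ xs ys {d} → d < length xs → inR (fromList (xs ++ ys)) (suc d) ≡ inR (fromList xs) (suc d)
inR-++ˡ (x ∷ xs) ys {zero} _ = refl
inR-++ˡ (x ∷ xs) ys {suc d} (s≤s d<xs) = inR-++ˡ xs ys d<xs

inR-++ʳ : ∀ xs ys d → inR (fromList (xs ++ ys)) (suc (length xs + d)) ≡ inR (fromList ys) (suc d)
inR-++ʳ [] ys d = refl
inR-++ʳ (x ∷ xs) ys d = inR-++ʳ xs ys d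

inR-++-∷ : ∀ xs b ys → inR (fromList (xs ++ b ∷ ys)) (suc (length xs)) ≡ b
inR-++-∷ [] b ys = refl
inR-++-∷ (x ∷ xs) b ys = inR-++-∷ xs b ys

inR-trues : ∀ m {d} → d < m → inR (fromList (replicate m true)) (suc d) ≡ true
inR-trues (suc m) {zero} _ = refl
inR-trues (suc m) {suc d} (s≤s d<m) = inR-trues m d<m

leftComb-admissible : ∀ m → Admissible (leftComb m) (fromList (replicate m true))
leftComb-admissible m x y _ below with label-bounds (proj₂ (LeftBelow-labels below))
... | d , d<m , refl = inR-trues m (subst (d <_) (size-leftComb m) d<m)

blockTree-admissible : ∀ bs → Admissible (blockTree bs) (fromList bs)
blockTree-admissible bs = go (blockView bs)
  where
  go : ∀ {bs} → BlockView bs → Admissible (blockTree bs) (fromList bs)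
  go (trues m) x y x∈R below =
    leftComb-admissible m x y x∈R (subst (λ t → LeftBelow 0 t x y) (blockTree-trues m) below)
  go (snoc {xs} v m) x y x∈R below =
    snoc-case (subst (λ t → LeftBelow 0 t x y) (blockTree-++-false-trues xs m) below) x∈R
    where
    ys = false ∷ replicate m true
    size-xs : size (blockTree xs) ≡ length xs
    size-xs = size-blockTree xs
    snoc-case : ∀ {x y} → LeftBelow 0 (blockTree xs ∨ leftComb m) x y →
          inR (fromList (xs ++ ys)) x ≡ true → inR (fromList (xs ++ ys)) y ≡ true
    snoc-case (here _ _) root∈R
      with () ← trans (sym (inR-++-∷ xs false _))
                      (subst (λ k → inR (fromList (xs ++ ys)) (suc k) ≡ true) size-xs root∈R)
    snoc-case (left _ below) x∈R with LeftBelow-labels below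
    ... | x-label , y-label with label-bounds x-label | label-bounds y-label
    ... | dx , dx< , refl | dy , dy< , refl =
      trans (inR-++ˡ xs ys (subst (dy <_) size-xs dy<))
        (go v _ _ (trans (sym (inR-++ˡ xs ys (subst (dx <_) size-xs dx<))) x∈R) below)
    snoc-case (right _ below) _ with label-bounds (proj₂ (LeftBelow-labels below))
    ... | d , d<m , refl =
      trans (cong (λ k → inR (fromList (xs ++ ys)) (suc (k + suc d))) size-xs)
        (trans (inR-++ʳ xs ys (suc d)) (inR-trues m (subst (d <_) (size-leftComb m) d<m)))

split-at : ∀ k m (bs : List Bool) → length bs ≡ k + suc m →
  Σ[ xs ∈ List Bool ] Σ[ b ∈ Bool ] Σ[ ys ∈ List Bool ]
    bs ≡ xs ++ b ∷ ys × length xs ≡ k × length ys ≡ m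
split-at zero m (b ∷ bs) eq = [] , b , bs , refl , refl , suc-injective eq
split-at (suc k) m (c ∷ bs) eq with split-at k m bs (suc-injective eq)
... | xs , b , ys , refl , refl , ys≡m = c ∷ xs , b , ys , refl , refl , ys≡m

all-in-R⇒trues : ∀ bs → (∀ d → d < length bs → inR (fromList bs) (suc d) ≡ true) →
  bs ≡ replicate (length bs) true
all-in-R⇒trues [] _ = refl
all-in-R⇒trues (b ∷ bs) all-in with all-in 0 z<s
... | refl = cong (true ∷_) (all-in-R⇒trues bs (λ d d< → all-in (suc d) (s≤s d<)))

module AdmissibleSplit (s t : Tree) (xs : List Bool) (b : Bool) (ys : List Bool)
         (xs≡s : length xs ≡ size s) (adm : Admissible (s ∨ t) (fromList (xs ++ b ∷ ys))) where

  Admissible-∨ˡ : Admissible s (fromList xs)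
  Admissible-∨ˡ x y x∈R below with LeftBelow-labels below
  ... | x-label , y-label with label-bounds x-label | label-bounds y-label
  ... | dx , dx< , refl | dy , dy< , refl =
    trans (sym (inR-++ˡ xs _ (subst (dy <_) (sym xs≡s) dy<)))
      (adm _ _ (trans (inR-++ˡ xs _ (subst (dx <_) (sym xs≡s) dx<)) x∈R) (left t below))

  Admissible-∨ʳ : Admissible t (fromList ys)
  Admissible-∨ʳ x y x∈R below with LeftBelow-labels below
  ... | x-label , y-label with label-bounds x-label | label-bounds y-label
  ... | dx , _ , refl | dy , _ , refl =
    trans (sym (shift dy)) (adm _ _ (trans (shift dx) x∈R) (right s shifted))
    where
    shifted : LeftBelow (suc (size s)) t (suc (size s) + suc dx) (suc (size s) + suc dy)
    shifted = subst (λ o → LeftBelow o t (suc (size s) + suc dx) (suc (size s) + suc dy)) (+-identityʳ _)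
                    (LeftBelow-shift (suc (size s)) below)
    shift : ∀ d → inR (fromList (xs ++ b ∷ ys)) (suc (size s) + suc d) ≡ inR (fromList ys) (suc d)
    shift d = trans (cong (λ k → inR (fromList (xs ++ b ∷ ys)) (suc (k + suc d))) (sym xs≡s))
                    (inR-++ʳ xs (b ∷ ys) (suc d))

  root∈R⇒trues : b ≡ true → xs ≡ replicate (length xs) true
  root∈R⇒trues refl = all-in-R⇒trues xs λ d d< →
    trans (sym (inR-++ˡ xs _ d<))
      (adm _ _ root∈R (here t (label-of-index 0 s (subst (d <_) xs≡s d<))))
    where
    root∈R : inR (fromList (xs ++ true ∷ ys)) (suc (size s)) ≡ true
    root∈R = subst (λ k → inR (fromList (xs ++ true ∷ ys)) (suc k) ≡ true) xs≡s (inR-++-∷ xs true ys)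

blockTree-≤T : ∀ r bs → length bs ≡ size r → Admissible r (fromList bs) → blockTree bs ≤T r
blockTree-≤T leaf [] _ _ = ε
blockTree-≤T (s ∨ t) bs bs≡r adm
  with split-at (size s) (size t) bs (trans bs≡r (sym (+-suc (size s) (size t))))
... | xs , b , ys , refl , xs≡s , ys≡t = by-root b refl
  where
  open AdmissibleSplit s t xs b ys xs≡s adm
  below-t : blockTree ys ≤T t
  below-t = blockTree-≤T t ys ys≡t Admissible-∨ʳ
  by-root : ∀ b′ → b ≡ b′ → blockTree (xs ++ b ∷ ys) ≤T (s ∨ t)
  by-root false refl = blockTree-++-false xs ys
    ◅◅ ∨-monoˡ-≤T _ (blockTree-≤T s xs xs≡s Admissible-∨ˡ)
    ◅◅ ∨-monoʳ-≤T s below-t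
  by-root true refl = subst (λ zs → blockTree (zs ++ true ∷ ys) ≤T (s ∨ t)) (sym (root∈R⇒trues refl))
    (subst (λ k → blockTree (replicate k true ++ true ∷ ys) ≤T (s ∨ t)) (sym xs≡s)
      (blockTree-trues-++-true (size s) ys
        ◅◅ ∨-monoˡ-≤T _ (leftComb-minimal s)
        ◅◅ ∨-monoʳ-≤T s below-t))

lam-π : ∀ bs → lam (π bs) ≡ blockTree bs
lam-π bs = lamF-π (length (π bs)) (blockView bs) (≤-reflexive (sym (length-piGo (#true bs) 0 0 bs)))

lam-π-≤T⇔Admissible : ∀ r bs → length bs ≡ size r →
  (lam (π bs) ≤T r) ⇔ Admissible r (fromList bs)
lam-π-≤T⇔Admissible r bs bs≡r = mk⇔
  (λ le → Admissible-mono {R = fromList bs} (subst (_≤T r) (lam-π bs) le) (blockTree-admissible bs))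
  (λ adm → subst (_≤T r) (sym (lam-π bs)) (blockTree-≤T r bs bs≡r adm))

fromList∘toList-invariant : ∀ {ℓ} {X : Set ℓ} (F : ∀ {n} → Vec Bool n → X) {n} (R : Vec Bool n) →
  F (fromList (toList R)) ≡ F R
fromList∘toList-invariant F R = trans (sym (F-cast (length-toList R) _)) (cong F (fromList∘toList R))
  where
  F-cast : ∀ {m n} (eq : m ≡ n) (v : Vec Bool m) → F (cast eq v) ≡ F v
  F-cast refl v = cong F (cast-is-id refl v)

lemma8p8 : (n : ℕ) (r : Tree) → size r ≡ n → (R : Vec Bool n) →
    (lam (piR R) ≤T r) ⇔ Admissible r R
lemma8p8 n r r≡n R =
  subst₂ (λ w A → (lam w ≤T r) ⇔ A)
    (fromList∘toList-invariant piR R) (fromList∘toList-invariant (Admissible r) R)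
    (lam-π-≤T⇔Admissible r (toList R) (trans (length-toList R) (sym r≡n)))
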